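{- Let $q$ be a power of $2$ and let $\Sigma$ be the graph defined below. Then $\Sigma$ is $q(q-1)/2$-regular.
   Context: In $\mathrm{PG}(2,q^2)$ (homogeneous coordinates over $\mathbb{F}_{q^2}$) consider the unitary polarity $(x,y,z)^\perp=[y^q,x^q,z^q]$, where $[a,b,c]$ is the line $aX+bY+cZ=0$; the graph $\mathrm{DUP}(q^2)$ has the points as vertices, $P$ adjacent to $Q$ iff $P\in Q^\perp$. Let $U_2=(0,1,0)$ and for $\lambda\in\mathbb{F}_q$ let $\mathcal{U}_\lambda$ be the Hermitian curve $\lambda X^{q+1}+X^qY+XY^q+Z^{q+1}=0$. Let $H$ be an additive subgroup of $\mathbb{F}_q$ of order $q/2$ with $1\notin H$, let $\Lambda=\{(h+1)^{ -1}: h\in H\}$, and let $\Sigma$ be the subgraph of $\mathrm{DUP}(q^2)$ induced on the point set $\bigcup_{\lambda\in\Lambda}\mathcal{U}_\lambda\setminus\{U_2\}$ (a set of $q^4/2$ non-absolute points). -}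

module Defs where

open import Data.Nat as ℕ using (ℕ; zero; suc)
open import Data.Fin using (Fin)
open import Data.Bool using (Bool; true; false; _∧_; not)
open import Data.List using (List; []; _∷_; _++_; map; concatMap; allFin; filterᵇ; length)
open import Data.Bool.ListAction using (any)
open import Data.Product using (∃; _×_; _,_)
open import Relation.Binary.PropositionalEquality using (_≡_; _≢_)
open import Relation.Binary.Definitions using (DecidableEquality)
open import Relation.Nullary.Decidable using (does)
open import Algebra.Structures using (IsCommutativeRing)
open import Function.Bundles using (_↔_; Inverse)

record FiniteField (size : ℕ) : Set₁ where
  infixl 7 _*_
  infixl 6 _+_
  field
    Carrier : Set
    _+_ _*_ : Carrier → Carrier → Carrier
    -_      : Carrier → Carrier
    0# 1#   : Carrier
    isCommutativeRing : IsCommutativeRing _≡_ _+_ _*_ -_ 0# 1#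
    0≢1     : 0# ≢ 1#
    inverse : ∀ x → x ≢ 0# → ∃ λ y → x * y ≡ 1#
    enum    : Fin size ↔ Carrier
    -- decidable equality (a consequence of finiteness, included for convenience)
    _≟_     : DecidableEquality Carrier

module DUP (q : ℕ) (F : FiniteField (q ℕ.* q)) where
  open FiniteField F

  infixr 8 _^_
  _^_ : Carrier → ℕ → Carrier
  x ^ zero  = 1#
  x ^ suc n = x * (x ^ n)

  _==_ : Carrier → Carrier → Bool
  x == y = does (x ≟ y)

  elems : List Carrier
  elems = map (Inverse.to enum) (allFin (q ℕ.* q))

  Triple : Set
  Triple = Carrier × Carrier × Carrier

  -- the points of PG(2,q²), each given by its unique normalised
  -- representative (first nonzero coordinate equal to 1):
  -- (1,y,z), (0,1,z), (0,0,1)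
  points : List Triple
  points = concatMap (λ y → map (λ z → (1# , y , z)) elems) elems
        ++ map (λ z → (0# , 1# , z)) elems
        ++ ((0# , 0# , 1#) ∷ [])

  -- P ∈ Q^⊥ where (x,y,z)^⊥ = [y^q, x^q, z^q]
  inPerp : Triple → Triple → Bool
  inPerp (x , y , z) (x' , y' , z') =
    ((y' ^ q) * x + (x' ^ q) * y + (z' ^ q) * z) == 0#

  adjacent : Triple → Triple → Bool
  adjacent P Q = inPerp P Q

  onU : Carrier → Triple → Bool
  onU l (x , y , z) =
    (l * x ^ (suc q) + (x ^ q) * y + x * (y ^ q) + z ^ (suc q)) == 0#

  -- λ ∈ Λ = {(h+1)⁻¹ : h ∈ H}, i.e. λ·(h+1) = 1 for some h ∈ H
  inΛ : (Carrier → Bool) → Carrier → Bool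
  inΛ H l = any (λ h → H h ∧ ((l * (h + 1#)) == 1#)) elems

  U₂ : Triple
  U₂ = (0# , 1# , 0#)

  isU₂ : Triple → Bool
  isU₂ (x , y , z) = (x == 0#) ∧ (y == 1#) ∧ (z == 0#)

  inΣ : (Carrier → Bool) → Triple → Bool
  inΣ H P = any (λ l → inΛ H l ∧ onU l P) elems ∧ not (isU₂ P)

  degreeΣ : (Carrier → Bool) → Triple → ℕ
  degreeΣ H P = length (filterᵇ (λ Q → inΣ H Q ∧ adjacent P Q) points)

  record GoodH (H : Carrier → Bool) : Set where
    field
      inFq   : ∀ h → H h ≡ true → h ^ q ≡ h
      zero∈  : H 0# ≡ true
      +-closed : ∀ a b → H a ≡ true → H b ≡ true → H (a + b) ≡ true
      neg-closed : ∀ a → H a ≡ true → H (- a) ≡ true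
      order  : 2 ℕ.* length (filterᵇ H elems) ≡ q
      one∉   : H 1# ≡ false

-- Write N x = x^(q+1) and λ(y, z) = y + y^q + N z.  An affine point (1, y, z) lies on U_λ only
-- for λ = λ(y, z), and apart from U₂ no point with X = 0 lies on any U_λ, so the vertices of Σ are
-- the (1, y, z) with λ(y, z) ∈ Λ.  In characteristic 2, (1, y′, z′) is adjacent to (1, y, z)
-- exactly when y′ = (y + z′^q z)^q, and then λ(y′, z′) = λ(y, z) + N(z + z′).  So the degree of
-- (1, y, z) counts the w with λ(y, z) + N w ∈ Λ, i.e. it is Σ_{u ∈ Λ} |N⁻¹(λ(y, z) + u)|.  Since
-- Λ ⊆ F_q, N⁻¹(0) = {0} and N is (q + 1)-to-1 from F_{q²}^* onto F_q^*, this is (q + 1)|Λ| − q,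
-- which equals q(q − 1)/2 because |Λ| = |H| = q/2.
module Submission where

open import Algebra.Bundles using (CommutativeRing)
open import Algebra.Structures using (IsCommutativeRing)
open import Data.Bool.Base using (Bool; true; false; _∧_; not; T)
open import Data.Bool.ListAction using (any)
open import Data.Bool.Properties using (∧-zeroʳ; ∧-identityʳ; ∧-conicalˡ; ∧-conicalʳ; T-≡)
open import Data.Empty using (⊥-elim)
open import Data.List.Base
  using (List; []; _∷_; _++_; map; concatMap; length; filterᵇ; allFin; foldr; replicate)
open import Data.List.Membership.Propositional using (_∈_; lose)
open import Data.List.Membership.Propositional.Properties
  using (∈-map⁺; ∈-map⁻; ∈-allFin; ∈-filter⁺; ∈-filter⁻; ∈-length; ∈-++⁻; ∈-concatMap⁻)
open import Data.List.Properties using (length-map; length-tabulate; length-replicate)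
open import Data.List.Relation.Binary.Permutation.Propositional using (_↭_; ↭⇒↭ₛ)
open import Data.List.Relation.Unary.All using (lookup)
open import Data.List.Relation.Unary.AllPairs using (_∷_)
open import Data.List.Relation.Unary.Any as Any using (here; there)
open import Data.List.Relation.Unary.Any.Properties using (any⁺; any⁻)
open import Data.List.Relation.Unary.Unique.Propositional using (Unique)
import Data.List.Relation.Unary.Unique.Propositional.Properties as Unique
open import Data.Maybe.Base using (nothing)
open import Data.Nat.Base using (ℕ; zero; suc)
import Data.Nat.Base as ℕ
open import Data.Nat.DivMod using (_/_; m*n/n≡m)
import Data.Nat.Properties as ℕₚ
open import Data.Nat.Solver using (module +-*-Solver)
open +-*-Solver using (con; _:+_; _:*_; _:=_) renaming (solve to solveℕ)
open import Data.Product.Base using (_×_; _,_; ∃; proj₁; proj₂)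
open import Data.Sum.Base using (_⊎_; inj₁; inj₂)
open import Data.Unit.Base using (tt)
open import Function.Base using (_∘_; case_of_)
open import Function.Bundles using (Inverse; Injection; Equivalence; mk⇔)
open import Function.Properties.Inverse using (↔⇒↣)
open import Relation.Binary.PropositionalEquality
open import Relation.Nullary.Decidable using (Dec; yes; no; dec-true; dec-false; does-⇔; T?)
import Tactic.RingSolver.Core.AlmostCommutativeRing as ACR

open import Defs

private variable
  A : Set

Bool-ext : {b c : Bool} → (b ≡ true → c ≡ true) → (c ≡ true → b ≡ true) → b ≡ c
Bool-ext {false} {false} _ _ = refl
Bool-ext {false} {true}  _ c⇒b = c⇒b refl
Bool-ext {true}  {false} b⇒c _ = sym (b⇒c refl)
Bool-ext {true}  {true}  _ _ = refl

any-≡false : (p : A → Bool) (xs : List A) → (∀ x → p x ≡ false) → any p xs ≡ false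
any-≡false p []       _        = refl
any-≡false p (x ∷ xs) p≡false rewrite p≡false x = any-≡false p xs p≡false

module Counting where

  private variable
    B : Set

  import Data.List.Relation.Binary.Permutation.Propositional.Properties as ↭
  open import Data.Nat.Base using (_+_; _*_; _≤_; z≤n)
  open import Data.Nat.ListAction using (sum)
  open import Data.Nat.ListAction.Properties using (sum-↭)
  open import Data.Nat.Properties
  open import Data.List.Membership.Propositional.Properties.WithK using (unique∧set⇒bag)
  open import Data.List.Relation.Binary.BagAndSetEquality using (∼bag⇒↭)
  open import Algebra.Properties.CommutativeSemigroup +-commutativeSemigroup
    using () renaming (interchange to +-interchange)


  𝟙 : Bool → ℕ
  𝟙 true  = 1
  𝟙 false = 0

  ∑ : (A → ℕ) → List A → ℕ
  ∑ f xs = sum (map f xs)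

  count : (A → Bool) → List A → ℕ
  count p = ∑ (𝟙 ∘ p)

  length-filterᵇ : (p : A → Bool) (xs : List A) → length (filterᵇ p xs) ≡ count p xs
  length-filterᵇ p [] = refl
  length-filterᵇ p (x ∷ xs) with p x
  ... | true  = cong suc (length-filterᵇ p xs)
  ... | false = length-filterᵇ p xs

  ∑-↭ : (f : A → ℕ) {xs ys : List A} → xs ↭ ys → ∑ f xs ≡ ∑ f ys
  ∑-↭ f = sum-↭ ∘ ↭.map⁺ f

  ∑-cong : {f g : A → ℕ} (xs : List A) → (∀ {x} → x ∈ xs → f x ≡ g x) → ∑ f xs ≡ ∑ g xs
  ∑-cong []       f≗g = refl
  ∑-cong (x ∷ xs) f≗g = cong₂ _+_ (f≗g (here refl)) (∑-cong xs (f≗g ∘ there))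

  ∑-map : (f : B → ℕ) (g : A → B) (xs : List A) → ∑ f (map g xs) ≡ ∑ (f ∘ g) xs
  ∑-map f g []       = refl
  ∑-map f g (x ∷ xs) = cong (f (g x) +_) (∑-map f g xs)

  ∑-++ : (f : A → ℕ) (xs ys : List A) → ∑ f (xs ++ ys) ≡ ∑ f xs + ∑ f ys
  ∑-++ f []       ys = refl
  ∑-++ f (x ∷ xs) ys = trans (cong (f x +_) (∑-++ f xs ys)) (sym (+-assoc (f x) _ _))

  ∑-concatMap : (f : B → ℕ) (g : A → List B) (xs : List A) →
                ∑ f (concatMap g xs) ≡ ∑ (∑ f ∘ g) xs
  ∑-concatMap f g []       = refl
  ∑-concatMap f g (x ∷ xs) =
    trans (∑-++ f (g x) (concatMap g xs)) (cong (∑ f (g x) +_) (∑-concatMap f g xs))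

  ∑-zero : (xs : List A) → ∑ (λ _ → 0) xs ≡ 0
  ∑-zero []       = refl
  ∑-zero (x ∷ xs) = ∑-zero xs

  ∑-one : (xs : List A) → ∑ (λ _ → 1) xs ≡ length xs
  ∑-one []       = refl
  ∑-one (x ∷ xs) = cong suc (∑-one xs)

  ∑-+ : (f g : A → ℕ) (xs : List A) → ∑ (λ x → f x + g x) xs ≡ ∑ f xs + ∑ g xs
  ∑-+ f g []       = refl
  ∑-+ f g (x ∷ xs) = trans (cong (f x + g x +_) (∑-+ f g xs)) (+-interchange (f x) (g x) _ _)

  ∑-*ˡ : (c : ℕ) (f : A → ℕ) (xs : List A) → ∑ (λ x → c * f x) xs ≡ c * ∑ f xs
  ∑-*ˡ c f []       = sym (*-zeroʳ c)
  ∑-*ˡ c f (x ∷ xs) = trans (cong (c * f x +_) (∑-*ˡ c f xs)) (sym (*-distribˡ-+ c (f x) _))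

  ∑-comm : (f : A → B → ℕ) (xs : List A) (ys : List B) →
           ∑ (λ x → ∑ (f x) ys) xs ≡ ∑ (λ y → ∑ (λ x → f x y) xs) ys
  ∑-comm f []       ys = sym (∑-zero ys)
  ∑-comm f (x ∷ xs) ys = trans (cong (∑ (f x) ys +_) (∑-comm f xs ys))
                               (sym (∑-+ (f x) (λ y → ∑ (λ x′ → f x′ y) xs) ys))

  ∑-delta : (f : A → ℕ) {a : A} {xs : List A} → Unique xs → a ∈ xs →
            (∀ {x} → x ∈ xs → x ≢ a → f x ≡ 0) → ∑ f xs ≡ f a
  ∑-delta f {xs = x ∷ xs} (x∉xs ∷ !xs) (here refl) f≡0 = begin
    f x + ∑ f xs           ≡⟨ cong (f x +_) (∑-cong xs (λ y∈xs → f≡0 (there y∈xs) (≢-sym (lookup x∉xs y∈xs)))) ⟩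
    f x + ∑ (λ _ → 0) xs   ≡⟨ cong (f x +_) (∑-zero xs) ⟩
    f x + 0                ≡⟨ +-identityʳ (f x) ⟩
    f x                    ∎
    where open ≡-Reasoning
  ∑-delta f {xs = x ∷ xs} (x∉xs ∷ !xs) (there a∈xs) f≡0 =
    trans (cong (_+ ∑ f xs) (f≡0 (here refl) (lookup x∉xs a∈xs)))
          (∑-delta f !xs a∈xs (f≡0 ∘ there))

  count-split : (p r : A → Bool) (xs : List A) →
                count p xs ≡ count (λ x → p x ∧ r x) xs + count (λ x → p x ∧ not (r x)) xs
  count-split p r []       = refl
  count-split p r (x ∷ xs) with p x | r x
  ... | true  | true  = cong suc (count-split p r xs)
  ... | true  | false = trans (cong suc (count-split p r xs)) (sym (+-suc _ _))
  ... | false | _     = count-split p r xs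

  ↭-from-∈ : {xs ys : List A} → Unique xs → Unique ys →
             (∀ {x} → x ∈ xs → x ∈ ys) → (∀ {x} → x ∈ ys → x ∈ xs) → xs ↭ ys
  ↭-from-∈ !xs !ys xs⊆ys ys⊆xs = ∼bag⇒↭ (unique∧set⇒bag !xs !ys (mk⇔ xs⊆ys ys⊆xs))

  ∑-mono-≤ : {f g : A → ℕ} (xs : List A) → (∀ {x} → x ∈ xs → f x ≤ g x) → ∑ f xs ≤ ∑ g xs
  ∑-mono-≤ []       f≤g = z≤n
  ∑-mono-≤ (x ∷ xs) f≤g = +-mono-≤ (f≤g (here refl)) (∑-mono-≤ xs (f≤g ∘ there))

  ∑-≤-rigid : {f g : A → ℕ} (xs : List A) → (∀ {x} → x ∈ xs → f x ≤ g x) →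
              ∑ g xs ≤ ∑ f xs → ∀ {x} → x ∈ xs → f x ≡ g x
  ∑-≤-rigid {f = f} {g} (x ∷ xs) f≤g g≤f x∈ = go x∈ (+-rigid (f≤g (here refl)) (∑-mono-≤ xs (f≤g ∘ there)) g≤f)
    where
    +-rigid : ∀ {a b c d} → a ≤ b → c ≤ d → b + d ≤ a + c → a ≡ b × d ≤ c
    +-rigid {a} {b} {c} {d} a≤b c≤d b+d≤a+c = ≤-antisym a≤b b≤a , d≤c
      where
      d≤c = +-cancelˡ-≤ b d c (≤-trans b+d≤a+c (+-monoˡ-≤ c a≤b))
      b≤a = +-cancelʳ-≤ d b a (≤-trans b+d≤a+c (+-monoʳ-≤ a c≤d))
    go : ∀ {y} → y ∈ x ∷ xs → f x ≡ g x × ∑ g xs ≤ ∑ f xs → f y ≡ g y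
    go (here refl)  (fx≡gx , _)    = fx≡gx
    go (there y∈xs) (_ , ∑g≤∑f)   = ∑-≤-rigid xs (f≤g ∘ there) ∑g≤∑f y∈xs

open Counting

-- Stated for fields of order q², the setting of `DUP`, so that its `_^_` and `elems` are reused.
module FieldOfSquareOrder (q : ℕ) (F : FiniteField (q ℕ.* q)) where

  open FiniteField F public
  open DUP q F public
  open IsCommutativeRing isCommutativeRing public
    using ( +-assoc; +-comm; +-identityˡ; +-identityʳ; -‿inverseˡ; -‿inverseʳ
          ; *-assoc; *-comm; *-identityˡ; *-identityʳ; distribˡ; distribʳ; zeroˡ; zeroʳ
          ; +-isCommutativeMonoid; *-isCommutativeMonoid )

  commutativeRing : CommutativeRing _ _
  commutativeRing = record { isCommutativeRing = isCommutativeRing }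

  open import Tactic.RingSolver.NonReflective
    (ACR.fromCommutativeRing commutativeRing (λ _ → nothing)) public
    using (solve; _⊜_; _⊕_; _⊗_; Κ)

  open import Algebra.Properties.Semiring.Mult (CommutativeRing.semiring commutativeRing) public
    using (×1-homo-*) renaming (_×_ to _×ₙ_)
  open import Data.List.Relation.Binary.Permutation.Setoid.Properties (setoid Carrier)
    using (foldr-commMonoid)

  ==⇒≡ : ∀ {x y} → (x == y) ≡ true → x ≡ y
  ==⇒≡ {x} {y} with x ≟ y
  ... | yes x≡y = λ _ → x≡y

  ≡⇒== : ∀ {x y} → x ≡ y → (x == y) ≡ true
  ≡⇒== {x} {y} = dec-true (x ≟ y)

  ≢⇒== : ∀ {x y} → x ≢ y → (x == y) ≡ false
  ≢⇒== {x} {y} = dec-false (x ≟ y)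

  ==⇒≢ : ∀ {x y} → (x == y) ≡ false → x ≢ y
  ==⇒≢ x==y≡false x≡y = case trans (sym x==y≡false) (≡⇒== x≡y) of λ ()

  1#≢0# : 1# ≢ 0#
  1#≢0# = ≢-sym 0≢1

  inv : Carrier → Carrier
  inv x with x ≟ 0#
  ... | yes _   = 0#
  ... | no  x≢0 = proj₁ (inverse x x≢0)

  *-inverseʳ : ∀ x → x ≢ 0# → x * inv x ≡ 1#
  *-inverseʳ x x≢0 with x ≟ 0#
  ... | yes x≡0  = ⊥-elim (x≢0 x≡0)
  ... | no  x≢0′ = proj₂ (inverse x x≢0′)

  inv-0# : inv 0# ≡ 0#
  inv-0# with 0# ≟ 0#
  ... | yes _   = refl
  ... | no  0≢0 = ⊥-elim (0≢0 refl)

  inv-*-cancel : ∀ {a} x → a ≢ 0# → inv a * (a * x) ≡ x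
  inv-*-cancel {a} x a≢0 = begin
    inv a * (a * x)  ≡⟨ *-assoc (inv a) a x ⟨
    inv a * a * x    ≡⟨ cong (_* x) (trans (*-comm (inv a) a) (*-inverseʳ a a≢0)) ⟩
    1# * x           ≡⟨ *-identityˡ x ⟩
    x                ∎
    where open ≡-Reasoning

  *-cancelˡ : ∀ {a x y} → a ≢ 0# → a * x ≡ a * y → x ≡ y
  *-cancelˡ {a} {x} {y} a≢0 ax≡ay =
    trans (sym (inv-*-cancel x a≢0)) (trans (cong (inv a *_) ax≡ay) (inv-*-cancel y a≢0))

  *-cancelʳ : ∀ {a x y} → a ≢ 0# → x * a ≡ y * a → x ≡ y
  *-cancelʳ {a} {x} {y} a≢0 xa≡ya = *-cancelˡ a≢0 (trans (*-comm a x) (trans xa≡ya (*-comm y a)))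

  *-≢0 : ∀ {x y} → x ≢ 0# → y ≢ 0# → x * y ≢ 0#
  *-≢0 {x} {y} x≢0 y≢0 xy≡0 = y≢0 (*-cancelˡ x≢0 (trans xy≡0 (sym (zeroʳ x))))

  inv-unique : ∀ {x y} → x * y ≡ 1# → y ≡ inv x
  inv-unique {x} {y} xy≡1 = *-cancelˡ x≢0 (trans xy≡1 (sym (*-inverseʳ x x≢0)))
    where
    x≢0 : x ≢ 0#
    x≢0 x≡0 = 0≢1 (trans (sym (zeroˡ y)) (trans (cong (_* y) (sym x≡0)) xy≡1))

  inv-≢0 : ∀ {x} → x ≢ 0# → inv x ≢ 0#
  inv-≢0 {x} x≢0 inv≡0 = 0≢1 (trans (sym (zeroʳ x)) (trans (cong (x *_) (sym inv≡0)) (*-inverseʳ x x≢0)))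

  inv-involutive : ∀ x → inv (inv x) ≡ x
  inv-involutive x = by-cases (x ≟ 0#)
    where
    by-cases : Dec (x ≡ 0#) → inv (inv x) ≡ x
    by-cases (yes refl) = trans (cong inv inv-0#) inv-0#
    by-cases (no  x≢0)  = sym (inv-unique (trans (*-comm (inv x) x) (*-inverseʳ x x≢0)))

  ^-distribˡ-+-* : ∀ x m n → x ^ (m ℕ.+ n) ≡ x ^ m * x ^ n
  ^-distribˡ-+-* x zero    n = sym (*-identityˡ _)
  ^-distribˡ-+-* x (suc m) n = trans (cong (x *_) (^-distribˡ-+-* x m n)) (sym (*-assoc x _ _))

  ^-*-assoc : ∀ x m n → (x ^ m) ^ n ≡ x ^ (n ℕ.* m)
  ^-*-assoc x m zero    = refl
  ^-*-assoc x m (suc n) = trans (cong (x ^ m *_) (^-*-assoc x m n)) (sym (^-distribˡ-+-* x m (n ℕ.* m)))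

  ^-distribʳ-* : ∀ x y n → (x * y) ^ n ≡ x ^ n * y ^ n
  ^-distribʳ-* x y zero    = sym (*-identityˡ 1#)
  ^-distribʳ-* x y (suc n) = trans (cong (x * y *_) (^-distribʳ-* x y n))
    (solve 4 (λ x y a b → x ⊗ y ⊗ (a ⊗ b) ⊜ x ⊗ a ⊗ (y ⊗ b)) refl x y (x ^ n) (y ^ n))

  1#^n≡1# : ∀ n → 1# ^ n ≡ 1#
  1#^n≡1# zero    = refl
  1#^n≡1# (suc n) = trans (*-identityˡ _) (1#^n≡1# n)

  0#^suc≡0# : ∀ n → 0# ^ suc n ≡ 0#
  0#^suc≡0# n = zeroˡ _

  ^-≢0 : ∀ {x} n → x ≢ 0# → x ^ n ≢ 0#
  ^-≢0 zero    x≢0 = 1#≢0#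
  ^-≢0 (suc n) x≢0 = *-≢0 x≢0 (^-≢0 n x≢0)

  elems-complete : ∀ x → x ∈ elems
  elems-complete x = subst (_∈ elems) (Inverse.strictlyInverseˡ enum x)
                           (∈-map⁺ (Inverse.to enum) (∈-allFin (Inverse.from enum x)))

  elems-unique : Unique elems
  elems-unique = Unique.map⁺ (Injection.injective (↔⇒↣ enum)) (Unique.allFin⁺ (q ℕ.* q))

  length-elems : length elems ≡ q ℕ.* q
  length-elems = trans (length-map (Inverse.to enum) (allFin (q ℕ.* q))) (length-tabulate (λ i → i))

  map-bijection-↭ : (g h : Carrier → Carrier) → (∀ x → g (h x) ≡ x) → (∀ x → h (g x) ≡ x) →
                    map g elems ↭ elems
  map-bijection-↭ g h gh hg = ↭-from-∈ (Unique.map⁺ g-injective elems-unique) elems-unique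
    (λ {x} _ → elems-complete x)
    (λ {x} _ → subst (_∈ map g elems) (gh x) (∈-map⁺ g (elems-complete (h x))))
    where
    g-injective : ∀ {a b} → g a ≡ g b → a ≡ b
    g-injective {a} {b} ga≡gb = trans (sym (hg a)) (trans (cong h ga≡gb) (hg b))

  ∑-bijection : (f : Carrier → ℕ) (g h : Carrier → Carrier) →
                (∀ x → g (h x) ≡ x) → (∀ x → h (g x) ≡ x) → ∑ f elems ≡ ∑ (f ∘ g) elems
  ∑-bijection f g h gh hg = trans (sym (∑-↭ f (map-bijection-↭ g h gh hg))) (∑-map f g elems)

  ∑-elems-delta : (f : Carrier → ℕ) (a : Carrier) → (∀ x → x ≢ a → f x ≡ 0) → ∑ f elems ≡ f a
  ∑-elems-delta f a f≡0 = ∑-delta f elems-unique (elems-complete a) (λ {x} _ → f≡0 x)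

  count-== : ∀ a → count (_== a) elems ≡ 1
  count-== a = trans (∑-elems-delta _ a (λ x x≢a → cong 𝟙 (≢⇒== x≢a))) (cong 𝟙 (≡⇒== refl))

  any-elems⁻ : ∀ p → any p elems ≡ true → ∃ λ x → p x ≡ true
  any-elems⁻ p any≡true with Any.satisfied (any⁻ p elems (Equivalence.from T-≡ any≡true))
  ... | x , T[px] = x , Equivalence.to T-≡ T[px]

  any-elems⁺ : ∀ p x → p x ≡ true → any p elems ≡ true
  any-elems⁺ p x px≡true = Equivalence.to T-≡ (any⁺ p (lose (elems-complete x) (Equivalence.from T-≡ px≡true)))

  ∑-fibres : (h : Carrier → ℕ) (f : A → Carrier) (xs : List A) →
             ∑ (h ∘ f) xs ≡ ∑ (λ b → h b ℕ.* count (λ w → f w == b) xs) elems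
  ∑-fibres h f xs = begin
    ∑ (h ∘ f) xs                                              ≡⟨ ∑-cong xs (λ {w} _ → sym (fibre-sum w)) ⟩
    ∑ (λ w → ∑ (λ b → h b ℕ.* 𝟙 (f w == b)) elems) xs        ≡⟨ ∑-comm (λ w b → h b ℕ.* 𝟙 (f w == b)) xs elems ⟩
    ∑ (λ b → ∑ (λ w → h b ℕ.* 𝟙 (f w == b)) xs) elems        ≡⟨ ∑-cong elems (λ {b} _ → ∑-*ˡ (h b) _ xs) ⟩
    ∑ (λ b → h b ℕ.* count (λ w → f w == b) xs) elems        ∎
    where
    open ≡-Reasoning
    fibre-sum : ∀ w → ∑ (λ b → h b ℕ.* 𝟙 (f w == b)) elems ≡ h (f w)
    fibre-sum w = trans
      (∑-elems-delta _ (f w) (λ b b≢fw → trans (cong (λ t → h b ℕ.* 𝟙 t) (≢⇒== (≢-sym b≢fw))) (ℕₚ.*-zeroʳ (h b))))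
      (trans (cong (λ t → h (f w) ℕ.* 𝟙 t) (≡⇒== refl)) (ℕₚ.*-identityʳ (h (f w))))

  count-points : (p : Triple → Bool) → (∀ z → p (0# , 1# , z) ≡ false) → p (0# , 0# , 1#) ≡ false →
                 count p points ≡ ∑ (λ z′ → count (λ y′ → p (1# , y′ , z′)) elems) elems
  count-points p p[0,1,z]≡false p[0,0,1]≡false = begin
    count p points
      ≡⟨ ∑-++ (𝟙 ∘ p) affine (map (λ z → (0# , 1# , z)) elems ++ (0# , 0# , 1#) ∷ []) ⟩
    count p affine ℕ.+ count p (map (λ z → (0# , 1# , z)) elems ++ (0# , 0# , 1#) ∷ [])
      ≡⟨ cong (count p affine ℕ.+_) count-at-infinity ⟩
    count p affine ℕ.+ 0
      ≡⟨ ℕₚ.+-identityʳ _ ⟩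
    count p affine
      ≡⟨ ∑-concatMap (𝟙 ∘ p) (λ y′ → map (λ z′ → (1# , y′ , z′)) elems) elems ⟩
    ∑ (λ y′ → count p (map (λ z′ → (1# , y′ , z′)) elems)) elems
      ≡⟨ ∑-cong elems (λ {y′} _ → ∑-map (𝟙 ∘ p) (λ z′ → (1# , y′ , z′)) elems) ⟩
    ∑ (λ y′ → count (λ z′ → p (1# , y′ , z′)) elems) elems
      ≡⟨ ∑-comm (λ y′ z′ → 𝟙 (p (1# , y′ , z′))) elems elems ⟩
    ∑ (λ z′ → count (λ y′ → p (1# , y′ , z′)) elems) elems
      ∎
    where
    open ≡-Reasoning
    affine = concatMap (λ y → map (λ z → (1# , y , z)) elems) elems
    count-at-infinity : count p (map (λ z → (0# , 1# , z)) elems ++ (0# , 0# , 1#) ∷ []) ≡ 0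
    count-at-infinity = begin
      count p (map (λ z → (0# , 1# , z)) elems ++ (0# , 0# , 1#) ∷ [])
        ≡⟨ ∑-++ (𝟙 ∘ p) (map (λ z → (0# , 1# , z)) elems) _ ⟩
      count p (map (λ z → (0# , 1# , z)) elems) ℕ.+ (𝟙 (p (0# , 0# , 1#)) ℕ.+ 0)
        ≡⟨ cong₂ ℕ._+_ (∑-map (𝟙 ∘ p) (λ z → (0# , 1# , z)) elems) (cong (λ b → 𝟙 b ℕ.+ 0) p[0,0,1]≡false) ⟩
      count (λ z → p (0# , 1# , z)) elems ℕ.+ 0
        ≡⟨ cong (ℕ._+ 0) (trans (∑-cong elems (λ {z} _ → cong 𝟙 (p[0,1,z]≡false z))) (∑-zero elems)) ⟩
      0 ∎

  points-cases : ∀ {P} → P ∈ points →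
                 (∃ λ y → ∃ λ z → P ≡ (1# , y , z)) ⊎ (∃ λ z → P ≡ (0# , 1# , z)) ⊎ P ≡ (0# , 0# , 1#)
  points-cases P∈ with ∈-++⁻ (concatMap (λ y → map (λ z → (1# , y , z)) elems) elems) P∈
  ... | inj₁ P∈affine with Any.satisfied (∈-concatMap⁻ (λ y → map (λ z → (1# , y , z)) elems) {xs = elems} P∈affine)
  ...   | y , P∈row with ∈-map⁻ (λ z → (1# , y , z)) P∈row
  ...     | z , _ , refl = inj₁ (y , z , refl)
  points-cases P∈ | inj₂ P∈infinite with ∈-++⁻ (map (λ z → (0# , 1# , z)) elems) P∈infinite
  ... | inj₁ P∈line with ∈-map⁻ (λ z → (0# , 1# , z)) P∈line
  ...   | z , _ , refl = inj₂ (inj₁ (z , refl))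
  points-cases P∈ | inj₂ P∈infinite | inj₂ (here refl) = inj₂ (inj₂ refl)

  units : List Carrier
  units = filterᵇ (λ x → not (x == 0#)) elems

  units-unique : Unique units
  units-unique = Unique.filter⁺ (λ x → T? (not (x == 0#))) elems-unique

  ≢0⇒∈units : ∀ {x} → x ≢ 0# → x ∈ units
  ≢0⇒∈units {x} x≢0 = ∈-filter⁺ (λ x → T? (not (x == 0#))) (elems-complete x) (subst (T ∘ not) (sym (≢⇒== x≢0)) tt)

  ∈units⇒≢0 : ∀ {x} → x ∈ units → x ≢ 0#
  ∈units⇒≢0 {x} x∈units x≡0 with ∈-filter⁻ (λ x → T? (not (x == 0#))) {xs = elems} x∈units
  ... | _ , T[x≢0] = subst (T ∘ not) (≡⇒== x≡0) T[x≢0]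

  suc-length-units : suc (length units) ≡ q ℕ.* q
  suc-length-units = begin
    suc (length units)                              ≡⟨ cong suc (length-filterᵇ _ elems) ⟩
    1 ℕ.+ count (λ x → not (x == 0#)) elems         ≡⟨ cong (ℕ._+ count (not ∘ (_== 0#)) elems) (count-== 0#) ⟨
    count (_== 0#) elems ℕ.+ count (not ∘ (_== 0#)) elems ≡⟨ count-split (λ _ → true) (_== 0#) elems ⟨
    count (λ _ → true) elems                        ≡⟨ ∑-one elems ⟩
    length elems                                    ≡⟨ length-elems ⟩
    q ℕ.* q                                         ∎
    where open ≡-Reasoning

  ∏ᶠ : List Carrier → Carrier
  ∏ᶠ = foldr _*_ 1#

  ∑ᶠ : List Carrier → Carrier
  ∑ᶠ = foldr _+_ 0#

  ∏ᶠ-↭ : ∀ {xs ys} → xs ↭ ys → ∏ᶠ xs ≡ ∏ᶠ ys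
  ∏ᶠ-↭ = foldr-commMonoid *-isCommutativeMonoid ∘ ↭⇒↭ₛ

  ∑ᶠ-↭ : ∀ {xs ys} → xs ↭ ys → ∑ᶠ xs ≡ ∑ᶠ ys
  ∑ᶠ-↭ = foldr-commMonoid +-isCommutativeMonoid ∘ ↭⇒↭ₛ

  ∏ᶠ-map-*ˡ : ∀ a xs → ∏ᶠ (map (a *_) xs) ≡ a ^ length xs * ∏ᶠ xs
  ∏ᶠ-map-*ˡ a []       = sym (*-identityˡ 1#)
  ∏ᶠ-map-*ˡ a (x ∷ xs) = trans (cong (a * x *_) (∏ᶠ-map-*ˡ a xs))
    (solve 4 (λ a x p r → a ⊗ x ⊗ (p ⊗ r) ⊜ a ⊗ p ⊗ (x ⊗ r)) refl a x (a ^ length xs) (∏ᶠ xs))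

  ∑ᶠ-map-+ˡ : ∀ a xs → ∑ᶠ (map (a +_) xs) ≡ length xs ×ₙ a + ∑ᶠ xs
  ∑ᶠ-map-+ˡ a []       = sym (+-identityˡ 0#)
  ∑ᶠ-map-+ˡ a (x ∷ xs) = trans (cong (a + x +_) (∑ᶠ-map-+ˡ a xs))
    (solve 4 (λ a x p r → (a ⊕ x ⊕ (p ⊕ r)) ⊜ (a ⊕ p ⊕ (x ⊕ r))) refl a x (length xs ×ₙ a) (∑ᶠ xs))

  ∏ᶠ-≢0 : ∀ {xs} → (∀ {x} → x ∈ xs → x ≢ 0#) → ∏ᶠ xs ≢ 0#
  ∏ᶠ-≢0 {[]}     _      = 1#≢0#
  ∏ᶠ-≢0 {x ∷ xs} xs≢0 = *-≢0 (xs≢0 (here refl)) (∏ᶠ-≢0 (xs≢0 ∘ there))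

  ^-length-units : ∀ {a} → a ≢ 0# → a ^ length units ≡ 1#
  ^-length-units {a} a≢0 = *-cancelˡ (∏ᶠ-≢0 ∈units⇒≢0) (begin
    ∏ᶠ units * a ^ length units   ≡⟨ *-comm _ _ ⟩
    a ^ length units * ∏ᶠ units   ≡⟨ ∏ᶠ-map-*ˡ a units ⟨
    ∏ᶠ (map (a *_) units)         ≡⟨ ∏ᶠ-↭ a*-permutes-units ⟩
    ∏ᶠ units                      ≡⟨ *-identityʳ _ ⟨
    ∏ᶠ units * 1#                 ∎)
    where
    open ≡-Reasoning
    a*-permutes-units : map (a *_) units ↭ units
    a*-permutes-units = ↭-from-∈ (Unique.map⁺ (*-cancelˡ a≢0) units-unique) units-unique
      (λ y∈ → case ∈-map⁻ (a *_) y∈ of λ where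
        (x , x∈ , refl) → ≢0⇒∈units (*-≢0 a≢0 (∈units⇒≢0 x∈)))
      (λ {y} y∈ → subst (_∈ map (a *_) units)
        (trans (sym (*-assoc a (inv a) y)) (trans (cong (_* y) (*-inverseʳ a a≢0)) (*-identityˡ y)))
        (∈-map⁺ (a *_) (≢0⇒∈units (*-≢0 (inv-≢0 a≢0) (∈units⇒≢0 y∈)))))

  fermat : ∀ x → x ^ (q ℕ.* q) ≡ x
  fermat x = subst (λ n → x ^ n ≡ x) suc-length-units (by-cases (x ≟ 0#))
    where
    by-cases : Dec (x ≡ 0#) → x ^ suc (length units) ≡ x
    by-cases (yes refl) = 0#^suc≡0# (length units)
    by-cases (no  x≢0)  = trans (cong (x *_) (^-length-units x≢0)) (*-identityʳ x)

  order×1#≡0# : (q ℕ.* q) ×ₙ 1# ≡ 0#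
  order×1#≡0# = cancel (begin
    (q ℕ.* q) ×ₙ 1# + ∑ᶠ elems        ≡⟨ cong (λ n → n ×ₙ 1# + ∑ᶠ elems) length-elems ⟨
    length elems ×ₙ 1# + ∑ᶠ elems     ≡⟨ ∑ᶠ-map-+ˡ 1# elems ⟨
    ∑ᶠ (map (1# +_) elems)           ≡⟨ ∑ᶠ-↭ (map-bijection-↭ (1# +_) (- 1# +_) (shift-back 1#) (shift-back′ 1#)) ⟩
    ∑ᶠ elems                         ∎)
    where
    open ≡-Reasoning
    cancel : ∀ {x s} → x + s ≡ s → x ≡ 0#
    cancel {x} {s} x+s≡s = begin
      x              ≡⟨ +-identityʳ x ⟨
      x + 0#         ≡⟨ cong (x +_) (-‿inverseʳ s) ⟨
      x + (s + - s)  ≡⟨ +-assoc x s (- s) ⟨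
      x + s + - s    ≡⟨ cong (_+ - s) x+s≡s ⟩
      s + - s        ≡⟨ -‿inverseʳ s ⟩
      0#             ∎
    shift-back : ∀ a x → a + (- a + x) ≡ x
    shift-back a x = trans (sym (+-assoc a (- a) x)) (trans (cong (_+ x) (-‿inverseʳ a)) (+-identityˡ x))
    shift-back′ : ∀ a x → - a + (a + x) ≡ x
    shift-back′ a x = trans (sym (+-assoc (- a) a x)) (trans (cong (_+ x) (-‿inverseˡ a)) (+-identityˡ x))

  -- monic (c₀ ∷ … ∷ cₖ₋₁) x = c₀ + c₁ x + ⋯ + cₖ₋₁ xᵏ⁻¹ + xᵏ, in Horner form.
  monic : List Carrier → Carrier → Carrier
  monic []       x = 1#
  monic (c ∷ cs) x = c + x * monic cs x

  monic-replicate-0# : ∀ k x → monic (replicate k 0#) x ≡ x ^ k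
  monic-replicate-0# zero    x = refl
  monic-replicate-0# (suc k) x = trans (+-identityˡ _) (cong (x *_) (monic-replicate-0# k x))

  -- f x − f r = (x − r) g x, with both sides moved so that no subtraction occurs.
  monic-divide : ∀ c cs r → ∃ λ ds → length ds ≡ length cs ×
                 (∀ x → monic (c ∷ cs) x + r * monic ds x ≡ x * monic ds x + monic (c ∷ cs) r)
  monic-divide c [] r = [] , refl , λ x →
    solve 3 (λ c x r → (c ⊕ x ⊗ Κ 1# ⊕ r ⊗ Κ 1#) ⊜ (x ⊗ Κ 1# ⊕ (c ⊕ r ⊗ Κ 1#))) refl c x r
  monic-divide c (d ∷ cs) r with monic-divide d cs r
  ... | ds , length-ds , divides = monic (d ∷ cs) r ∷ ds , cong suc length-ds , λ x → begin
    c + x * f x + r * (f r + x * g x)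
      ≡⟨ solve 6 (λ c x r fx fr gx → (c ⊕ x ⊗ fx ⊕ r ⊗ (fr ⊕ x ⊗ gx)) ⊜ (c ⊕ r ⊗ fr ⊕ x ⊗ (fx ⊕ r ⊗ gx)))
                 refl c x r (f x) (f r) (g x) ⟩
    c + r * f r + x * (f x + r * g x)
      ≡⟨ cong (λ t → c + r * f r + x * t) (divides x) ⟩
    c + r * f r + x * (x * g x + f r)
      ≡⟨ solve 5 (λ c x r fr gx → (c ⊕ r ⊗ fr ⊕ x ⊗ (x ⊗ gx ⊕ fr)) ⊜ (x ⊗ (fr ⊕ x ⊗ gx) ⊕ (c ⊕ r ⊗ fr)))
                 refl c x r (f r) (g x) ⟩
    x * (f r + x * g x) + (c + r * f r)
      ∎
    where
    open ≡-Reasoning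
    f = monic (d ∷ cs)
    g = monic ds

  roots≤degree : ∀ cs rs → Unique rs → (∀ {r} → r ∈ rs → monic cs r ≡ 0#) → length rs ℕ.≤ length cs
  roots≤degree cs       []       _             _      = ℕ.z≤n
  roots≤degree []       (r ∷ rs) _             roots  = ⊥-elim (1#≢0# (roots (here refl)))
  roots≤degree (c ∷ cs) (r ∷ rs) (r∉rs ∷ !rs) roots with monic-divide c cs r
  ... | ds , length-ds , divides =
    ℕ.s≤s (subst (length rs ℕ.≤_) length-ds (roots≤degree ds rs !rs quotient-roots))
    where
    quotient-roots : ∀ {s} → s ∈ rs → monic ds s ≡ 0#
    quotient-roots {s} s∈rs with monic ds s ≟ 0#
    ... | yes gs≡0 = gs≡0
    ... | no  gs≢0 = ⊥-elim (lookup r∉rs s∈rs (sym (*-cancelʳ gs≢0 (begin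
      s * monic ds s                          ≡⟨ +-identityʳ _ ⟨
      s * monic ds s + 0#                     ≡⟨ cong (s * monic ds s +_) (roots (here refl)) ⟨
      s * monic ds s + monic (c ∷ cs) r       ≡⟨ divides s ⟨
      monic (c ∷ cs) s + r * monic ds s       ≡⟨ cong (_+ r * monic ds s) (roots (there s∈rs)) ⟩
      0# + r * monic ds s                     ≡⟨ +-identityˡ _ ⟩
      r * monic ds s                          ∎))))
      where open ≡-Reasoning

  count-roots≤degree : ∀ cs (p : Carrier → Bool) → (∀ x → p x ≡ true → monic cs x ≡ 0#) →
                       count p elems ℕ.≤ length cs
  count-roots≤degree cs p roots = subst (ℕ._≤ length cs) (length-filterᵇ p elems)
    (roots≤degree cs (filterᵇ p elems) (Unique.filter⁺ (T? ∘ p) elems-unique)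
      (λ {r} r∈ → roots r (T⇒≡ (proj₂ (∈-filter⁻ (T? ∘ p) {xs = elems} r∈)))))
    where
    T⇒≡ : ∀ {b} → T b → b ≡ true
    T⇒≡ {true} _ = refl

module CharacteristicTwo (n : ℕ) (F : FiniteField (2 ℕ.^ n ℕ.* 2 ℕ.^ n)) where

  open FieldOfSquareOrder (2 ℕ.^ n) F public

  q : ℕ
  q = 2 ℕ.^ n

  1#+1#≡0# : 1# + 1# ≡ 0#
  1#+1#≡0# with (2 ×ₙ 1#) ≟ 0#
  ... | yes 2×1≡0 = trans (cong (1# +_) (sym (+-identityʳ 1#))) 2×1≡0
  ... | no  2×1≢0 = ⊥-elim (2^k×1≢0 (n ℕ.+ n) (trans (cong (_×ₙ 1#) (ℕₚ.^-distribˡ-+-* 2 n n)) order×1#≡0#))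
    where
    2^k×1≢0 : ∀ k → (2 ℕ.^ k) ×ₙ 1# ≢ 0#
    2^k×1≢0 zero    = subst (_≢ 0#) (sym (+-identityʳ 1#)) 1#≢0#
    2^k×1≢0 (suc k) = subst (_≢ 0#) (sym (×1-homo-* 2 (2 ℕ.^ k))) (*-≢0 2×1≢0 (2^k×1≢0 k))

  x+x≡0# : ∀ x → x + x ≡ 0#
  x+x≡0# x = begin
    x + x              ≡⟨ cong₂ _+_ (*-identityˡ x) (*-identityˡ x) ⟨
    1# * x + 1# * x    ≡⟨ distribʳ x 1# 1# ⟨
    (1# + 1#) * x      ≡⟨ cong (_* x) 1#+1#≡0# ⟩
    0# * x             ≡⟨ zeroˡ x ⟩
    0#                 ∎
    where open ≡-Reasoning

  +-cancel : ∀ a x → a + (a + x) ≡ x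
  +-cancel a x = trans (sym (+-assoc a a x)) (trans (cong (_+ x) (x+x≡0# a)) (+-identityˡ x))

  +≡0#⇒≡ : ∀ {a b} → a + b ≡ 0# → a ≡ b
  +≡0#⇒≡ {a} {b} a+b≡0 = begin
    a             ≡⟨ +-cancel b a ⟨
    b + (b + a)   ≡⟨ cong (b +_) (trans (+-comm b a) a+b≡0) ⟩
    b + 0#        ≡⟨ +-identityʳ b ⟩
    b             ∎
    where open ≡-Reasoning

  ≡⇒+≡0# : ∀ {a b} → a ≡ b → a + b ≡ 0#
  ≡⇒+≡0# {a} refl = x+x≡0# a

  ^2-+ : ∀ a b → (a + b) ^ 2 ≡ a ^ 2 + b ^ 2
  ^2-+ a b = begin
    (a + b) ^ 2                        ≡⟨ x^2≡x*x (a + b) ⟩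
    (a + b) * (a + b)                  ≡⟨ solve 2 (λ a b → ((a ⊕ b) ⊗ (a ⊕ b)) ⊜ (a ⊗ a ⊕ b ⊗ b ⊕ (a ⊗ b ⊕ a ⊗ b))) refl a b ⟩
    a * a + b * b + (a * b + a * b)    ≡⟨ cong (a * a + b * b +_) (x+x≡0# (a * b)) ⟩
    a * a + b * b + 0#                 ≡⟨ +-identityʳ _ ⟩
    a * a + b * b                      ≡⟨ cong₂ _+_ (x^2≡x*x a) (x^2≡x*x b) ⟨
    a ^ 2 + b ^ 2                      ∎
    where
    open ≡-Reasoning
    x^2≡x*x : ∀ x → x ^ 2 ≡ x * x
    x^2≡x*x x = cong (x *_) (*-identityʳ x)

  ^2^k-+ : ∀ k a b → (a + b) ^ (2 ℕ.^ k) ≡ a ^ (2 ℕ.^ k) + b ^ (2 ℕ.^ k)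
  ^2^k-+ zero    a b = distribʳ 1# a b
  ^2^k-+ (suc k) a b = begin
    (a + b) ^ (2 ℕ.* 2 ℕ.^ k)                  ≡⟨ ^-*-assoc (a + b) (2 ℕ.^ k) 2 ⟨
    ((a + b) ^ (2 ℕ.^ k)) ^ 2                  ≡⟨ cong (_^ 2) (^2^k-+ k a b) ⟩
    (a ^ (2 ℕ.^ k) + b ^ (2 ℕ.^ k)) ^ 2        ≡⟨ ^2-+ _ _ ⟩
    (a ^ (2 ℕ.^ k)) ^ 2 + (b ^ (2 ℕ.^ k)) ^ 2  ≡⟨ cong₂ _+_ (^-*-assoc a (2 ℕ.^ k) 2) (^-*-assoc b (2 ℕ.^ k) 2) ⟩
    a ^ (2 ℕ.* 2 ℕ.^ k) + b ^ (2 ℕ.* 2 ℕ.^ k)  ∎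
    where open ≡-Reasoning

  ^q-+ : ∀ a b → (a + b) ^ q ≡ a ^ q + b ^ q
  ^q-+ = ^2^k-+ n

  ^q-involutive : ∀ x → (x ^ q) ^ q ≡ x
  ^q-involutive x = trans (^-*-assoc x q q) (fermat x)

  q≡2+ : ∃ λ k → q ≡ suc (suc k)
  q≡2+ = at-least-2 q (subst (2 ℕ.≤_) suc-length-units (ℕ.s≤s (∈-length (≢0⇒∈units 1#≢0#))))
    where
    at-least-2 : ∀ m → 2 ℕ.≤ m ℕ.* m → ∃ λ k → m ≡ suc (suc k)
    at-least-2 (suc zero)    (ℕ.s≤s ())
    at-least-2 (suc (suc k)) _ = k , refl

  0#^q≡0# : 0# ^ q ≡ 0#
  0#^q≡0# with q≡2+
  ... | k , q≡2+k = trans (cong (0# ^_) q≡2+k) (0#^suc≡0# (suc k))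

  isFq : Carrier → Bool
  isFq c = (c ^ q) == c

  isFq* : Carrier → Bool
  isFq* c = isFq c ∧ not (c == 0#)

  count-Fq≤q : count isFq elems ℕ.≤ q
  count-Fq≤q with q≡2+
  ... | k , q≡2+k = subst₂ ℕ._≤_ refl (trans (cong (suc ∘ suc) (length-replicate k)) (sym q≡2+k))
    (count-roots≤degree (0# ∷ 1# ∷ replicate k 0#) isFq x^q+x≡0)
    where
    x^q+x≡0 : ∀ x → isFq x ≡ true → monic (0# ∷ 1# ∷ replicate k 0#) x ≡ 0#
    x^q+x≡0 x x^q≡x = begin
      0# + x * (1# + x * monic (replicate k 0#) x)  ≡⟨ cong (λ t → 0# + x * (1# + x * t)) (monic-replicate-0# k x) ⟩
      0# + x * (1# + x * x ^ k)                     ≡⟨ +-identityˡ _ ⟩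
      x * (1# + x * x ^ k)                          ≡⟨ distribˡ x 1# _ ⟩
      x * 1# + x ^ suc (suc k)                      ≡⟨ cong (_+ x ^ suc (suc k)) (*-identityʳ x) ⟩
      x + x ^ suc (suc k)                           ≡⟨ cong (λ m → x + x ^ m) q≡2+k ⟨
      x + x ^ q                                     ≡⟨ ≡⇒+≡0# (sym (==⇒≡ x^q≡x)) ⟩
      0#                                            ∎
      where open ≡-Reasoning

  count-Fq*+1≡count-Fq : count isFq* elems ℕ.+ 1 ≡ count isFq elems
  count-Fq*+1≡count-Fq = begin
    count isFq* elems ℕ.+ 1                                   ≡⟨ cong (count isFq* elems ℕ.+_) count-zero ⟨
    count isFq* elems ℕ.+ count (λ c → isFq c ∧ (c == 0#)) elems ≡⟨ ℕₚ.+-comm (count isFq* elems) _ ⟩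
    count (λ c → isFq c ∧ (c == 0#)) elems ℕ.+ count isFq* elems ≡⟨ count-split isFq (_== 0#) elems ⟨
    count isFq elems                                          ∎
    where
    open ≡-Reasoning
    count-zero : count (λ c → isFq c ∧ (c == 0#)) elems ≡ 1
    count-zero = trans
      (∑-elems-delta _ 0# (λ c c≢0 → trans (cong (λ b → 𝟙 (isFq c ∧ b)) (≢⇒== c≢0)) (cong 𝟙 (∧-zeroʳ (isFq c)))))
      (cong₂ (λ b b′ → 𝟙 (b ∧ b′)) (≡⇒== 0#^q≡0#) (≡⇒== refl))

  N : Carrier → Carrier
  N x = x ^ suc q

  N-∈Fq : ∀ x → N x ^ q ≡ N x
  N-∈Fq x = begin
    (x * x ^ q) ^ q       ≡⟨ ^-distribʳ-* x (x ^ q) q ⟩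
    x ^ q * (x ^ q) ^ q   ≡⟨ cong (x ^ q *_) (^q-involutive x) ⟩
    x ^ q * x             ≡⟨ *-comm (x ^ q) x ⟩
    x * x ^ q             ∎
    where open ≡-Reasoning

  N==0#≡x==0# : ∀ x → (N x == 0#) ≡ (x == 0#)
  N==0#≡x==0# x with x ≟ 0#
  ... | yes refl = ≡⇒== (0#^suc≡0# q)
  ... | no  x≢0  = ≢⇒== (^-≢0 (suc q) x≢0)

  fibre : Carrier → ℕ
  fibre c = count (λ x → N x == c) elems

  fibre≤ : ∀ c → fibre c ℕ.≤ suc q
  fibre≤ c = subst (fibre c ℕ.≤_) (cong suc (length-replicate q))
    (count-roots≤degree (c ∷ replicate q 0#) (λ x → N x == c) λ x Nx≡c →
      trans (cong (λ t → c + x * t) (monic-replicate-0# q x)) (≡⇒+≡0# (sym (==⇒≡ Nx≡c))))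

  fibre-0# : fibre 0# ≡ 1
  fibre-0# = trans (∑-cong elems (λ {x} _ → cong 𝟙 (N==0#≡x==0# x))) (count-== 0#)

  isFq*-N : ∀ x → isFq* (N x) ≡ not (x == 0#)
  isFq*-N x = cong₂ (λ b b′ → b ∧ not b′) (≡⇒== (N-∈Fq x)) (N==0#≡x==0# x)

  ∑-fibres-Fq* : ∑ (λ c → 𝟙 (isFq* c) ℕ.* fibre c) elems ≡ length units
  ∑-fibres-Fq* = begin
    ∑ (λ c → 𝟙 (isFq* c) ℕ.* fibre c) elems  ≡⟨ ∑-fibres (𝟙 ∘ isFq*) N elems ⟨
    count (isFq* ∘ N) elems                    ≡⟨ ∑-cong elems (λ {x} _ → cong 𝟙 (isFq*-N x)) ⟩
    count (λ x → not (x == 0#)) elems          ≡⟨ length-filterᵇ _ elems ⟨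
    length units                               ∎
    where open ≡-Reasoning

  suc-q*count-Fq*≤length-units : suc q ℕ.* count isFq* elems ℕ.≤ length units
  suc-q*count-Fq*≤length-units with q≡2+
  ... | k , q≡2+k = begin
    suc q ℕ.* count isFq* elems  ≤⟨ ℕₚ.*-monoʳ-≤ (suc q) count-Fq*≤ ⟩
    suc q ℕ.* suc k              ≡⟨ cong (λ m → suc m ℕ.* suc k) q≡2+k ⟩
    (3 ℕ.+ k) ℕ.* (1 ℕ.+ k)      ≡⟨ cong ℕ.pred (trans [k+3][k+1]+1≡[k+2]² (sym (cong₂ ℕ._*_ q≡2+k q≡2+k))) ⟩
    ℕ.pred (q ℕ.* q)             ≡⟨ cong ℕ.pred suc-length-units ⟨
    length units                 ∎
    where
    open ℕₚ.≤-Reasoning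
    count-Fq*≤ : count isFq* elems ℕ.≤ suc k
    count-Fq*≤ = ℕₚ.≤-pred (subst₂ ℕ._≤_ (trans (sym count-Fq*+1≡count-Fq) (ℕₚ.+-comm _ 1)) q≡2+k count-Fq≤q)
    [k+3][k+1]+1≡[k+2]² : suc ((3 ℕ.+ k) ℕ.* (1 ℕ.+ k)) ≡ (2 ℕ.+ k) ℕ.* (2 ℕ.+ k)
    [k+3][k+1]+1≡[k+2]² = solveℕ 1 (λ k → con 1 :+ (con 3 :+ k) :* (con 1 :+ k) := (con 2 :+ k) :* (con 2 :+ k)) refl k

  -- Each of the at most q − 1 nonzero norms has at most q + 1 preimages, and there are q² − 1 units.
  fibre-Fq* : ∀ c → isFq* c ≡ true → fibre c ≡ suc q
  fibre-Fq* c c∈Fq* = begin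
    fibre c                          ≡⟨ ℕₚ.*-identityˡ (fibre c) ⟨
    1 ℕ.* fibre c                    ≡⟨ cong (λ b → 𝟙 b ℕ.* fibre c) c∈Fq* ⟨
    𝟙 (isFq* c) ℕ.* fibre c          ≡⟨ ∑-≤-rigid elems (λ {b} _ → weighted-fibre≤ b) ∑-bound≤∑-fibres (elems-complete c) ⟩
    suc q ℕ.* 𝟙 (isFq* c)            ≡⟨ cong (λ b → suc q ℕ.* 𝟙 b) c∈Fq* ⟩
    suc q ℕ.* 1                      ≡⟨ ℕₚ.*-identityʳ (suc q) ⟩
    suc q                            ∎
    where
    open ≡-Reasoning
    weighted-fibre≤ : ∀ b → 𝟙 (isFq* b) ℕ.* fibre b ℕ.≤ suc q ℕ.* 𝟙 (isFq* b)
    weighted-fibre≤ b with isFq* b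
    ... | true  = subst₂ ℕ._≤_ (sym (ℕₚ.*-identityˡ _)) (sym (ℕₚ.*-identityʳ _)) (fibre≤ b)
    ... | false = ℕ.z≤n
    ∑-bound≤∑-fibres : ∑ (λ b → suc q ℕ.* 𝟙 (isFq* b)) elems ℕ.≤ ∑ (λ b → 𝟙 (isFq* b) ℕ.* fibre b) elems
    ∑-bound≤∑-fibres = subst₂ ℕ._≤_ (sym (∑-*ˡ (suc q) _ elems)) (sym ∑-fibres-Fq*) suc-q*count-Fq*≤length-units

module Σ-Degree (n : ℕ) (F : FiniteField (2 ℕ.^ n ℕ.* 2 ℕ.^ n))
                (H : FiniteField.Carrier F → Bool) (goodH : DUP.GoodH (2 ℕ.^ n) F H) where

  open CharacteristicTwo n F public
  open GoodH goodH

  x+1#+1#≡x : ∀ x → x + 1# + 1# ≡ x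
  x+1#+1#≡x x = trans (+-assoc x 1# 1#) (trans (cong (x +_) 1#+1#≡0#) (+-identityʳ x))

  ∈Λ-witness : ∀ {u} → inΛ H u ≡ true → ∃ λ h → H h ≡ true × u * (h + 1#) ≡ 1#
  ∈Λ-witness u∈Λ with any-elems⁻ _ u∈Λ
  ... | h , h∈H∧u[h+1]≡1 = h , ∧-conicalˡ _ _ h∈H∧u[h+1]≡1 , ==⇒≡ (∧-conicalʳ _ _ h∈H∧u[h+1]≡1)

  inΛ≡H[inv+1#] : ∀ u → inΛ H u ≡ H (inv u + 1#)
  inΛ≡H[inv+1#] u = Bool-ext to from
    where
    to : inΛ H u ≡ true → H (inv u + 1#) ≡ true
    to u∈Λ with ∈Λ-witness u∈Λ
    ... | h , h∈H , u[h+1]≡1 = subst (λ t → H t ≡ true) (trans (sym (x+1#+1#≡x h)) (cong (_+ 1#) (inv-unique u[h+1]≡1))) h∈H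
    from : H (inv u + 1#) ≡ true → inΛ H u ≡ true
    from inv-u+1∈H = by-cases (u ≟ 0#)
      where
      by-cases : Dec (u ≡ 0#) → inΛ H u ≡ true
      by-cases (yes refl) = case trans (sym inv-u+1∈H) (trans (cong (λ t → H (t + 1#)) inv-0#) (trans (cong H (+-identityˡ 1#)) one∉)) of λ ()
      by-cases (no  u≢0)  = any-elems⁺ _ (inv u + 1#) (cong₂ _∧_ inv-u+1∈H
        (≡⇒== (trans (cong (u *_) (x+1#+1#≡x (inv u))) (*-inverseʳ u u≢0))))

  ∈Λ⇒∈Fq : ∀ {u} → inΛ H u ≡ true → u ^ q ≡ u
  ∈Λ⇒∈Fq {u} u∈Λ with ∈Λ-witness u∈Λ
  ... | h , h∈H , u[h+1]≡1 = *-cancelʳ h+1≢0 (begin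
    u ^ q * (h + 1#)          ≡⟨ cong (u ^ q *_) (trans (^q-+ h 1#) (cong₂ _+_ (inFq h h∈H) (1#^n≡1# q))) ⟨
    u ^ q * (h + 1#) ^ q      ≡⟨ ^-distribʳ-* u (h + 1#) q ⟨
    (u * (h + 1#)) ^ q        ≡⟨ cong (_^ q) u[h+1]≡1 ⟩
    1# ^ q                    ≡⟨ 1#^n≡1# q ⟩
    1#                        ≡⟨ u[h+1]≡1 ⟨
    u * (h + 1#)              ∎)
    where
    open ≡-Reasoning
    h+1≢0 : h + 1# ≢ 0#
    h+1≢0 h+1≡0 = 0≢1 (trans (sym (zeroʳ u)) (trans (cong (u *_) (sym h+1≡0)) u[h+1]≡1))

  2*count-Λ≡q : 2 ℕ.* count (inΛ H) elems ≡ q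
  2*count-Λ≡q = trans (cong (2 ℕ.*_) count-Λ≡count-H) (trans (cong (2 ℕ.*_) (sym (length-filterᵇ H elems))) order)
    where
    count-Λ≡count-H : count (inΛ H) elems ≡ count H elems
    count-Λ≡count-H = trans (∑-cong elems (λ {u} _ → cong 𝟙 (inΛ≡H[inv+1#] u)))
      (sym (∑-bijection (𝟙 ∘ H) (λ u → inv u + 1#) (λ v → inv (v + 1#))
        (λ v → trans (cong (_+ 1#) (inv-involutive (v + 1#))) (x+1#+1#≡x v))
        (λ u → trans (cong inv (x+1#+1#≡x (inv u))) (inv-involutive u))))

  λ[_,_] : Carrier → Carrier → Carrier
  λ[ y , z ] = y + y ^ q + N z

  onU-affine : ∀ l y z → onU l (1# , y , z) ≡ (l == λ[ y , z ])
  onU-affine l y z = does-⇔ (mk⇔ (+≡0#⇒≡ ∘ trans (sym equation)) (trans equation ∘ ≡⇒+≡0#)) (_ ≟ 0#) (l ≟ λ[ y , z ])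
    where
    equation : l * 1# ^ suc q + 1# ^ q * y + 1# * y ^ q + z ^ suc q ≡ l + λ[ y , z ]
    equation = begin
      l * 1# ^ suc q + 1# ^ q * y + 1# * y ^ q + N z  ≡⟨ cong₂ (λ a b → l * a + b * y + 1# * y ^ q + N z) (1#^n≡1# (suc q)) (1#^n≡1# q) ⟩
      l * 1# + 1# * y + 1# * y ^ q + N z              ≡⟨ cong₂ (λ a b → a + b + 1# * y ^ q + N z) (*-identityʳ l) (*-identityˡ y) ⟩
      l + y + 1# * y ^ q + N z                        ≡⟨ cong (λ a → l + y + a + N z) (*-identityˡ (y ^ q)) ⟩
      l + y + y ^ q + N z                             ≡⟨ solve 4 (λ l y Y Nz → (l ⊕ y ⊕ Y ⊕ Nz) ⊜ (l ⊕ (y ⊕ Y ⊕ Nz))) refl l y (y ^ q) (N z) ⟩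
      l + λ[ y , z ]                                  ∎
      where open ≡-Reasoning

  inΣ-affine : ∀ y z → inΣ H (1# , y , z) ≡ inΛ H λ[ y , z ]
  inΣ-affine y z = begin
    inΣ H (1# , y , z)
      ≡⟨ cong (λ b → any (λ l → inΛ H l ∧ onU l (1# , y , z)) elems ∧ not (b ∧ (y == 1#) ∧ (z == 0#)))
              (≢⇒== 1#≢0#) ⟩
    any (λ l → inΛ H l ∧ onU l (1# , y , z)) elems ∧ true      ≡⟨ ∧-identityʳ _ ⟩
    any (λ l → inΛ H l ∧ onU l (1# , y , z)) elems             ≡⟨ Bool-ext to from ⟩
    inΛ H λ[ y , z ]                                           ∎
    where
    open ≡-Reasoning
    to : any (λ l → inΛ H l ∧ onU l (1# , y , z)) elems ≡ true → inΛ H λ[ y , z ] ≡ true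
    to any≡true with any-elems⁻ _ any≡true
    ... | l , l∈Λ∧onU = subst (λ t → inΛ H t ≡ true)
      (==⇒≡ (trans (sym (onU-affine l y z)) (∧-conicalʳ _ _ l∈Λ∧onU))) (∧-conicalˡ _ _ l∈Λ∧onU)
    from : inΛ H λ[ y , z ] ≡ true → any (λ l → inΛ H l ∧ onU l (1# , y , z)) elems ≡ true
    from λ∈Λ = any-elems⁺ _ λ[ y , z ] (cong₂ _∧_ λ∈Λ (trans (onU-affine _ y z) (≡⇒== refl)))

  0#+0#+0#+x≡x : ∀ x → 0# + 0# + 0# + x ≡ x
  0#+0#+0#+x≡x x = trans (cong (λ a → a + 0# + x) (+-identityˡ 0#))
                  (trans (cong (_+ x) (+-identityˡ 0#)) (+-identityˡ x))

  onU-0-1-z : ∀ l {z} → z ≢ 0# → onU l (0# , 1# , z) ≡ false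
  onU-0-1-z l {z} z≢0 = ≢⇒== (subst (_≢ 0#) (sym value) (^-≢0 (suc q) z≢0))
    where
    value : l * 0# ^ suc q + 0# ^ q * 1# + 0# * 1# ^ q + N z ≡ N z
    value = begin
      l * 0# ^ suc q + 0# ^ q * 1# + 0# * 1# ^ q + N z  ≡⟨ cong₂ (λ a b → l * a + b * 1# + 0# * 1# ^ q + N z) (0#^suc≡0# q) 0#^q≡0# ⟩
      l * 0# + 0# * 1# + 0# * 1# ^ q + N z              ≡⟨ cong₂ (λ a b → a + 0# * 1# + b + N z) (zeroʳ l) (zeroˡ (1# ^ q)) ⟩
      0# + 0# * 1# + 0# + N z                           ≡⟨ cong (λ a → 0# + a + 0# + N z) (zeroˡ 1#) ⟩
      0# + 0# + 0# + N z                                ≡⟨ 0#+0#+0#+x≡x (N z) ⟩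
      N z                                               ∎
      where open ≡-Reasoning

  onU-0-0-1 : ∀ l → onU l (0# , 0# , 1#) ≡ false
  onU-0-0-1 l = ≢⇒== (subst (_≢ 0#) (sym value) 1#≢0#)
    where
    value : l * 0# ^ suc q + 0# ^ q * 0# + 0# * 0# ^ q + 1# ^ suc q ≡ 1#
    value = begin
      l * 0# ^ suc q + 0# ^ q * 0# + 0# * 0# ^ q + 1# ^ suc q  ≡⟨ cong₂ (λ a b → l * a + b * 0# + 0# * b + 1# ^ suc q) (0#^suc≡0# q) 0#^q≡0# ⟩
      l * 0# + 0# * 0# + 0# * 0# + 1# ^ suc q                  ≡⟨ cong (l * 0# + 0# * 0# + 0# * 0# +_) (1#^n≡1# (suc q)) ⟩
      l * 0# + 0# * 0# + 0# * 0# + 1#                          ≡⟨ cong₂ (λ a b → a + b + b + 1#) (zeroʳ l) (zeroˡ 0#) ⟩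
      0# + 0# + 0# + 1#                                        ≡⟨ 0#+0#+0#+x≡x 1# ⟩
      1#                                                       ∎
      where open ≡-Reasoning

  inΣ-off-curves : ∀ P → (∀ l → onU l P ≡ false) → inΣ H P ≡ false
  inΣ-off-curves P P∉U = cong (_∧ not (isU₂ P))
    (any-≡false _ elems (λ l → trans (cong (inΛ H l ∧_) (P∉U l)) (∧-zeroʳ (inΛ H l))))

  inΣ-0-1-z : ∀ z → inΣ H (0# , 1# , z) ≡ false
  inΣ-0-1-z z = by-cases (z ≟ 0#)
    where
    isU₂-U₂ : isU₂ U₂ ≡ true
    isU₂-U₂ rewrite ≡⇒== {0#} {0#} refl | ≡⇒== {1#} {1#} refl = refl
    by-cases : Dec (z ≡ 0#) → inΣ H (0# , 1# , z) ≡ false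
    by-cases (yes refl) = trans (cong (λ b → any (λ l → inΛ H l ∧ onU l U₂) elems ∧ not b) isU₂-U₂) (∧-zeroʳ _)
    by-cases (no  z≢0)  = inΣ-off-curves (0# , 1# , z) (λ l → onU-0-1-z l z≢0)

  inΣ-0-0-1 : inΣ H (0# , 0# , 1#) ≡ false
  inΣ-0-0-1 = inΣ-off-curves (0# , 0# , 1#) onU-0-0-1

  module Neighbourhood (y z : Carrier) where

    neighbour : Carrier → Carrier
    neighbour z′ = (y + z′ ^ q * z) ^ q

    adjacent-affine : ∀ y′ z′ → adjacent (1# , y , z) (1# , y′ , z′) ≡ (y′ == neighbour z′)
    adjacent-affine y′ z′ = does-⇔ (mk⇔ to from) (_ ≟ 0#) (y′ ≟ neighbour z′)
      where
      equation : y′ ^ q * 1# + 1# ^ q * y + z′ ^ q * z ≡ y′ ^ q + (y + z′ ^ q * z)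
      equation = begin
        y′ ^ q * 1# + 1# ^ q * y + z′ ^ q * z  ≡⟨ cong₂ (λ a b → a + b * y + z′ ^ q * z) (*-identityʳ (y′ ^ q)) (1#^n≡1# q) ⟩
        y′ ^ q + 1# * y + z′ ^ q * z           ≡⟨ cong (λ a → y′ ^ q + a + z′ ^ q * z) (*-identityˡ y) ⟩
        y′ ^ q + y + z′ ^ q * z                ≡⟨ +-assoc (y′ ^ q) y (z′ ^ q * z) ⟩
        y′ ^ q + (y + z′ ^ q * z)              ∎
        where open ≡-Reasoning
      to : y′ ^ q * 1# + 1# ^ q * y + z′ ^ q * z ≡ 0# → y′ ≡ neighbour z′
      to ≡0 = trans (sym (^q-involutive y′)) (cong (_^ q) (+≡0#⇒≡ (trans (sym equation) ≡0)))
      from : y′ ≡ neighbour z′ → y′ ^ q * 1# + 1# ^ q * y + z′ ^ q * z ≡ 0#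
      from y′≡ = trans equation (≡⇒+≡0# (trans (cong (_^ q) y′≡) (^q-involutive _)))

    λ-neighbour : ∀ z′ → λ[ neighbour z′ , z′ ] ≡ λ[ y , z ] + N (z + z′)
    λ-neighbour z′ = sym (begin
      y + y ^ q + N z + (z + z′) * (z + z′) ^ q
        ≡⟨ cong (λ t → y + y ^ q + N z + (z + z′) * t) (^q-+ z z′) ⟩
      y + y ^ q + N z + (z + z′) * (z ^ q + z′ ^ q)
        ≡⟨ solve 7 (λ y Y z z′ A B V → ((y ⊕ Y ⊕ V) ⊕ (z ⊕ z′) ⊗ (A ⊕ B))
                                   ⊜ ((Y ⊕ z′ ⊗ A ⊕ (y ⊕ B ⊗ z) ⊕ z′ ⊗ B) ⊕ (V ⊕ z ⊗ A)))
                   refl y (y ^ q) z z′ (z ^ q) (z′ ^ q) (N z) ⟩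
      y ^ q + z′ * z ^ q + (y + z′ ^ q * z) + N z′ + (N z + N z)
        ≡⟨ cong (y ^ q + z′ * z ^ q + (y + z′ ^ q * z) + N z′ +_) (x+x≡0# (N z)) ⟩
      y ^ q + z′ * z ^ q + (y + z′ ^ q * z) + N z′ + 0#
        ≡⟨ +-identityʳ _ ⟩
      y ^ q + z′ * z ^ q + (y + z′ ^ q * z) + N z′
        ≡⟨ cong₂ (λ a b → a + b + N z′) (sym neighbour-expanded) (sym (^q-involutive _)) ⟩
      neighbour z′ + neighbour z′ ^ q + N z′ ∎)
      where
      open ≡-Reasoning
      neighbour-expanded : neighbour z′ ≡ y ^ q + z′ * z ^ q
      neighbour-expanded = trans (^q-+ y (z′ ^ q * z))
        (cong (y ^ q +_) (trans (^-distribʳ-* (z′ ^ q) z q) (cong (_* z ^ q) (^q-involutive z′))))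

    degree-affine : degreeΣ H (1# , y , z) ≡ count (λ z′ → inΛ H (λ[ y , z ] + N (z + z′))) elems
    degree-affine = begin
      degreeΣ H (1# , y , z)
        ≡⟨ length-filterᵇ neighbour? points ⟩
      count neighbour? points
        ≡⟨ count-points neighbour? (λ z′ → cong (_∧ _) (inΣ-0-1-z z′)) (cong (_∧ _) inΣ-0-0-1) ⟩
      ∑ (λ z′ → count (λ y′ → neighbour? (1# , y′ , z′)) elems) elems
        ≡⟨ ∑-cong elems (λ {z′} _ → count-column z′) ⟩
      count (λ z′ → inΛ H (λ[ y , z ] + N (z + z′))) elems
        ∎
      where
      open ≡-Reasoning
      neighbour? : Triple → Bool
      neighbour? Q = inΣ H Q ∧ adjacent (1# , y , z) Q
      count-column : ∀ z′ → count (λ y′ → neighbour? (1# , y′ , z′)) elems ≡ 𝟙 (inΛ H (λ[ y , z ] + N (z + z′)))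
      count-column z′ = trans
        (∑-elems-delta _ (neighbour z′) λ y′ y′≢ → cong 𝟙
          (trans (cong (inΣ H (1# , y′ , z′) ∧_) (trans (adjacent-affine y′ z′) (≢⇒== y′≢))) (∧-zeroʳ _)))
        (cong 𝟙 (begin
          inΣ H (1# , neighbour z′ , z′) ∧ adjacent (1# , y , z) (1# , neighbour z′ , z′)
            ≡⟨ cong (inΣ H (1# , neighbour z′ , z′) ∧_) (trans (adjacent-affine _ z′) (≡⇒== refl)) ⟩
          inΣ H (1# , neighbour z′ , z′) ∧ true  ≡⟨ ∧-identityʳ _ ⟩
          inΣ H (1# , neighbour z′ , z′)         ≡⟨ inΣ-affine _ z′ ⟩
          inΛ H λ[ neighbour z′ , z′ ]           ≡⟨ cong (inΛ H) (λ-neighbour z′) ⟩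
          inΛ H (λ[ y , z ] + N (z + z′))        ∎))

    degree-as-fibre-sum : degreeΣ H (1# , y , z) ≡ ∑ (λ u → 𝟙 (inΛ H u) ℕ.* fibre (λ[ y , z ] + u)) elems
    degree-as-fibre-sum = begin
      degreeΣ H (1# , y , z)
        ≡⟨ degree-affine ⟩
      count (λ z′ → inΛ H (a + N (z + z′))) elems
        ≡⟨ ∑-bijection (λ w → 𝟙 (inΛ H (a + N w))) (z +_) (z +_) (+-cancel z) (+-cancel z) ⟨
      count (λ w → inΛ H (a + N w)) elems
        ≡⟨ ∑-fibres (λ b → 𝟙 (inΛ H (a + b))) N elems ⟩
      ∑ (λ b → 𝟙 (inΛ H (a + b)) ℕ.* fibre b) elems
        ≡⟨ ∑-bijection _ (a +_) (a +_) (+-cancel a) (+-cancel a) ⟩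
      ∑ (λ u → 𝟙 (inΛ H (a + (a + u))) ℕ.* fibre (a + u)) elems
        ≡⟨ ∑-cong elems (λ {u} _ → cong (λ t → 𝟙 (inΛ H t) ℕ.* fibre (a + u)) (+-cancel a u)) ⟩
      ∑ (λ u → 𝟙 (inΛ H u) ℕ.* fibre (a + u)) elems
        ∎
      where
      open ≡-Reasoning
      a = λ[ y , z ]

  ∑-fibres-over-Λ : ∀ a → inΛ H a ≡ true →
    ∑ (λ u → 𝟙 (inΛ H u) ℕ.* fibre (a + u)) elems ℕ.+ q ≡ suc q ℕ.* count (inΛ H) elems
  ∑-fibres-over-Λ a a∈Λ = begin
    S ℕ.+ q                                                              ≡⟨ cong (S ℕ.+_) (ℕₚ.*-identityʳ q) ⟨
    S ℕ.+ q ℕ.* 1                                                        ≡⟨ cong (λ t → S ℕ.+ q ℕ.* t) (count-== a) ⟨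
    S ℕ.+ q ℕ.* count (_== a) elems                                      ≡⟨ cong (S ℕ.+_) (∑-*ˡ q _ elems) ⟨
    S ℕ.+ ∑ (λ u → q ℕ.* 𝟙 (u == a)) elems                               ≡⟨ ∑-+ _ _ elems ⟨
    ∑ (λ u → 𝟙 (inΛ H u) ℕ.* fibre (a + u) ℕ.+ q ℕ.* 𝟙 (u == a)) elems  ≡⟨ ∑-cong elems (λ {u} _ → pointwise u) ⟩
    ∑ (λ u → suc q ℕ.* 𝟙 (inΛ H u)) elems                                ≡⟨ ∑-*ˡ (suc q) _ elems ⟩
    suc q ℕ.* count (inΛ H) elems                                        ∎
    where
    open ≡-Reasoning
    S = ∑ (λ u → 𝟙 (inΛ H u) ℕ.* fibre (a + u)) elems
    a+u∈Fq* : ∀ {u} → inΛ H u ≡ true → u ≢ a → isFq* (a + u) ≡ true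
    a+u∈Fq* {u} u∈Λ u≢a = cong₂ (λ b b′ → b ∧ not b′)
      (≡⇒== (trans (^q-+ a u) (cong₂ _+_ (∈Λ⇒∈Fq a∈Λ) (∈Λ⇒∈Fq u∈Λ))))
      (≢⇒== (u≢a ∘ sym ∘ +≡0#⇒≡))
    -- For u ∈ Λ, a + u lies in F_q, and is 0 only for u = a.
    pointwise : ∀ u → 𝟙 (inΛ H u) ℕ.* fibre (a + u) ℕ.+ q ℕ.* 𝟙 (u == a) ≡ suc q ℕ.* 𝟙 (inΛ H u)
    pointwise u = by-cases (inΛ H u) refl (u == a) refl
      where
      by-cases : ∀ b → inΛ H u ≡ b → ∀ c → (u == a) ≡ c →
                 𝟙 b ℕ.* fibre (a + u) ℕ.+ q ℕ.* 𝟙 c ≡ suc q ℕ.* 𝟙 b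
      by-cases false u∉Λ true  u≡a = case trans (sym u∉Λ) (subst (λ t → inΛ H t ≡ true) (sym (==⇒≡ u≡a)) a∈Λ) of λ ()
      by-cases false _   false _   = trans (ℕₚ.*-zeroʳ q) (sym (ℕₚ.*-zeroʳ (suc q)))
      by-cases true  _   true  u≡a = cong (λ f → 1 ℕ.* f ℕ.+ q ℕ.* 1)
        (trans (cong (λ t → fibre (a + t)) (==⇒≡ u≡a)) (trans (cong fibre (x+x≡0# a)) fibre-0#))
      by-cases true  u∈Λ false u≢a = begin
        1 ℕ.* fibre (a + u) ℕ.+ q ℕ.* 0   ≡⟨ cong (λ f → 1 ℕ.* f ℕ.+ q ℕ.* 0) (fibre-Fq* (a + u) (a+u∈Fq* u∈Λ (==⇒≢ u≢a))) ⟩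
        1 ℕ.* suc q ℕ.+ q ℕ.* 0           ≡⟨ cong₂ ℕ._+_ (ℕₚ.*-identityˡ (suc q)) (ℕₚ.*-zeroʳ q) ⟩
        suc q ℕ.+ 0                       ≡⟨ ℕₚ.+-identityʳ (suc q) ⟩
        suc q                             ≡⟨ ℕₚ.*-identityʳ (suc q) ⟨
        suc q ℕ.* 1                       ∎

  degree-affine+q : ∀ y z → inΣ H (1# , y , z) ≡ true → degreeΣ H (1# , y , z) ℕ.+ q ≡ suc q ℕ.* count (inΛ H) elems
  degree-affine+q y z P∈Σ = trans (cong (ℕ._+ q) (Neighbourhood.degree-as-fibre-sum y z))
    (∑-fibres-over-Λ λ[ y , z ] (trans (sym (inΣ-affine y z)) P∈Σ))

  degree+q : ∀ {P} → P ∈ points → inΣ H P ≡ true → degreeΣ H P ℕ.+ q ≡ suc q ℕ.* count (inΛ H) elems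
  degree+q P∈points P∈Σ with points-cases P∈points
  ... | inj₁ (y , z , refl)    = degree-affine+q y z P∈Σ
  ... | inj₂ (inj₁ (z , refl)) = case trans (sym P∈Σ) (inΣ-0-1-z z) of λ ()
  ... | inj₂ (inj₂ refl)       = case trans (sym P∈Σ) inΣ-0-0-1 of λ ()

half-of-2L[2L-1] : ∀ S L → S ℕ.+ 2 ℕ.* L ≡ suc (2 ℕ.* L) ℕ.* L → S ≡ 2 ℕ.* L ℕ.* (2 ℕ.* L ℕ.∸ 1) / 2
half-of-2L[2L-1] S zero    S+0≡0 = trans (sym (ℕₚ.+-identityʳ S)) S+0≡0
half-of-2L[2L-1] S (suc l) S+2L≡[2L+1]L = begin
  S                               ≡⟨ ℕₚ.+-cancelʳ-≡ (2 ℕ.* suc l) S (suc l ℕ.* (2 ℕ.* l ℕ.+ 1)) (trans S+2L≡[2L+1]L (sym L[2L-1]+2L)) ⟩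
  suc l ℕ.* (2 ℕ.* l ℕ.+ 1)       ≡⟨ m*n/n≡m _ 2 ⟨
  suc l ℕ.* (2 ℕ.* l ℕ.+ 1) ℕ.* 2 / 2  ≡⟨ cong (_/ 2) 2L[2L-1]≡ ⟩
  2 ℕ.* suc l ℕ.* (2 ℕ.* suc l ℕ.∸ 1) / 2 ∎
  where
  open ≡-Reasoning
  L[2L-1]+2L : suc l ℕ.* (2 ℕ.* l ℕ.+ 1) ℕ.+ 2 ℕ.* suc l ≡ suc (2 ℕ.* suc l) ℕ.* suc l
  L[2L-1]+2L = solveℕ 1 (λ l → ((con 1 :+ l) :* (con 2 :* l :+ con 1) :+ con 2 :* (con 1 :+ l))
                            := ((con 1 :+ con 2 :* (con 1 :+ l)) :* (con 1 :+ l))) refl l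
  2L[2L-1]≡ : suc l ℕ.* (2 ℕ.* l ℕ.+ 1) ℕ.* 2 ≡ 2 ℕ.* suc l ℕ.* (2 ℕ.* suc l ℕ.∸ 1)
  2L[2L-1]≡ = solveℕ 1 (λ l → ((con 1 :+ l) :* (con 2 :* l :+ con 1) :* con 2)
                           := (con 2 :* (con 1 :+ l) :* (l :+ (con 1 :+ (l :+ con 0))))) refl l

open import Data.Nat.Base using (_*_; _∸_; _^_)

proposition3 : (n : ℕ) → (F : FiniteField ((2 ^ n) * (2 ^ n)))
  → (H : FiniteField.Carrier F → Bool) → DUP.GoodH (2 ^ n) F H
  → ∀ P → P ∈ DUP.points (2 ^ n) F → DUP.inΣ (2 ^ n) F H P ≡ true
  → DUP.degreeΣ (2 ^ n) F H P ≡ ((2 ^ n) * ((2 ^ n) ∸ 1)) / 2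
proposition3 n F H goodH P P∈points P∈Σ =
  subst (λ m → degreeΣ H P ≡ m ℕ.* (m ℕ.∸ 1) / 2) 2*count-Λ≡q
    (half-of-2L[2L-1] (degreeΣ H P) L
      (subst (λ m → degreeΣ H P ℕ.+ m ≡ suc m ℕ.* L) (sym 2*count-Λ≡q) (degree+q P∈points P∈Σ)))
  where
  open Σ-Degree n F H goodH
  L = count (inΛ H) elems
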